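{- Let $G$ be a formula and let $\sigma_1,\dots,\sigma_n/\sigma$ be an instance of a rule $\mathcal R$ of $\mathbf{FRJ}(G)$ with premises $\sigma_1,\dots,\sigma_n$ and conclusion $\sigma$. If $\sigma'_1,\dots,\sigma'_n$ are $\mathbf{FRJ}(G)$-sequents with $\sigma_i\sqsubseteq\sigma'_i$ for all $i$, then there is an instance $\sigma'_1,\dots,\sigma'_n/\sigma'$ of the same rule $\mathcal R$ in $\mathbf{FRJ}(G)$ with $\sigma\sqsubseteq\sigma'$.
   Context: Formulas are built from a countably infinite set $\mathcal{V}$ of propositional variables and $\bot$ using $\land,\lor,\supset$. Let $\mathcal{V}_\bot=\mathcal{V}\cup\{\bot\}$, $\mathcal{L}^{\supset}$ the set of formulas with main connective $\supset$. For a formula $G$, $\mathrm{Sl}(G)$ and $\mathrm{Sr}(G)$ are the smallest subsets of the subformulas of $G$ with: $G\in\mathrm{Sr}(G)$; $A\land B$ or $A\lor B$ in $\mathrm{Sl}(G)$ (resp. $\mathrm{Sr}(G)$) implies $A,B$ in $\mathrm{Sl}(G)$ (resp. $\mathrm{Sr}(G)$); $A\supset B\in\mathrm{Sl}(G)$ implies $B\in\mathrm{Sl}(G)$, $A\in\mathrm{Sr}(G)$; $A\supset B\in\mathrm{Sr}(G)$ implies $B\in\mathrm{Sr}(G)$, $A\in\mathrm{Sl}(G)$. $\mathrm{Cl}(\Gamma)$ is the smallest set containing $\Gamma$ such that if $X,Y\in\mathrm{Cl}(\Gamma)$ and $A$ is any formula then $X\land Y,A\lor X,X\lor A,A\supset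 X\in\mathrm{Cl}(\Gamma)$. $\mathbf{FRJ}(G)$: let $\bar\Gamma^{At}=\mathrm{Sl}(G)\cap\mathcal V$, $\bar\Gamma^{\supset}=\mathrm{Sl}(G)\cap\mathcal L^{\supset}$, $\bar\Gamma=\bar\Gamma^{At}\cup\bar\Gamma^{\supset}$. Sequents: regular $\Gamma\Rightarrow C$ ($\Gamma\subseteq\bar\Gamma$, $C\in\mathrm{Sr}(G)$), irregular $\Sigma;\Theta\rightarrow C$ ($\Sigma\cup\Theta\subseteq\bar\Gamma$, $C\in\mathrm{Sr}(G)$); conclusions always have right formula in $\mathrm{Sr}(G)$. Rules ($F\in\mathcal V_\bot$, $k\in\{1,2\}$): axioms $\bar\Gamma^{At}\setminus\{F\}\Rightarrow F$ and $\emptyset;(\bar\Gamma^{At}\setminus\{F\})\cup\bar\Gamma^{\supset}\rightarrow F$; ($\land$) $\Gamma\Rightarrow A_k/\Gamma\Rightarrow A_1\land A_2$ and $\Sigma;\Theta\rightarrow A_k/\Sigma;\Theta\rightarrow A_1\land A_2$; ($\lor$) $\Sigma_1;\Theta_1\rightarrow C_1$, $\Sigma_2;\Theta_2\rightarrow C_2 / \Sigma_1\cup\Sigma_2;\Theta_1\cap\Theta_2\rightarrow C_1\lor C_2$ if $\Sigma_1\subseteq\Sigma_2\cup\Theta_2$, $\Sigma_2\subseteq\Sigma_1\cup\Theta_1$; ($\supset_\in$) $\Gamma\Rightarrow B/\Gamma\Rightarrow A\supset B$ if $A\in\mathrm{Cl}(\Gamma)$, and $\Sigma;\Theta\cup\Lambda\rightarrow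 B/\Sigma\cup\Lambda;\Theta\rightarrow A\supset B$ if $\Theta\cap\Lambda=\emptyset$, $A\in\mathrm{Cl}(\Sigma\cup\Lambda)$ and no $\Lambda'\subsetneq\Lambda$ has $A\in\mathrm{Cl}(\Sigma\cup\Lambda')$; ($\supset_{\notin}$) $\Gamma\Rightarrow B/\emptyset;\Theta\rightarrow A\supset B$ if $\Theta\subseteq\mathrm{Cl}(\Gamma)\cap\bar\Gamma$, $A\in\mathrm{Cl}(\Gamma)\setminus\mathrm{Cl}(\Theta)$ and every $\Theta'$ with $\Theta\subsetneq\Theta'\subseteq\mathrm{Cl}(\Gamma)\cap\bar\Gamma$ has $A\in\mathrm{Cl}(\Theta')$; join rules with premises $\Sigma_j;\Theta_j\rightarrow A_j$ ($1\le j\le n$, $n\ge1$): let $\Upsilon=\{A_1,\dots,A_n\}$, $\Sigma^{At}=\bigcup_j(\Sigma_j\cap\mathcal V)$, $\Sigma^{\supset}=\bigcup_j(\Sigma_j\cap\mathcal L^{\supset})$, $\Theta^{At}=\bigcap_j(\Theta_j\cap\mathcal V)$, $\Theta^{\supset}=\{Y\supset Z\in\bigcap_j(\Theta_j\cap\mathcal L^{\supset}):Y\in\Upsilon\}$, requiring $\Sigma_i\subseteq\Sigma_j\cup\Theta_j$ ($i\ne j$) and ($Y\supset Z\in\Sigma^{\supset}\Rightarrow Y\in\Upsilon$); ($\bowtie^{At}$) conclusion $\Sigma^{At}\cup(\Theta^{At}\setminus\{F\})\cup\Sigma^{\supset}\cup\Theta^{\supset}\Rightarrow F$, $F\in\mathcal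 V_\bot\setminus\Sigma^{At}$, where each $Y\in\Upsilon$ has some $Y\supset Z\in\mathrm{Sl}(G)$; ($\bowtie^{\lor}$) conclusion $\Sigma^{At}\cup\Theta^{At}\cup\Sigma^{\supset}\cup\Theta^{\supset}\Rightarrow C_1\lor C_2$, $\{C_1,C_2\}\subseteq\Upsilon$, where each $Y\in\Upsilon$ has some $Y\supset Z\in\mathrm{Sl}(G)$ or $Y\lor Z\in\mathrm{Sr}(G)$ or $Z\lor Y\in\mathrm{Sr}(G)$. Subsumption: $\sigma_1\sqsubseteq\sigma_2$ iff either $\sigma_1=\Gamma_1\Rightarrow C$, $\sigma_2=\Gamma_2\Rightarrow C$ with $\Gamma_1\subseteq\Gamma_2$, or $\sigma_1=\Sigma;\Theta_1\rightarrow C$, $\sigma_2=\Sigma;\Theta_2\rightarrow C$ (same $\Sigma$ and $C$) with $\Theta_1\subseteq\Theta_2$. -}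

module Defs where

open import Data.Nat using (ℕ; suc)
open import Data.Fin using (Fin)
open import Data.List using (List; []; _∷_; tabulate)
open import Data.List.Membership.Propositional using (_∈_)
open import Data.List.Relation.Binary.Pointwise using (Pointwise)
open import Data.List.Relation.Unary.All using (All)
open import Data.Product using (_×_; ∃; ∃-syntax; Σ-syntax)
open import Data.Sum using (_⊎_)
open import Data.Empty using (⊥)
open import Relation.Nullary using (¬_)
open import Relation.Binary.PropositionalEquality using (_≡_; _≢_)

infixr 6 _∧_
infixr 5 _∨_
infixr 4 _⊃_

data Fm : Set where
  var  : ℕ → Fm
  falsum : Fm
  _∧_ _∨_ _⊃_ : Fm → Fm → Fm

IsVar : Fm → Set
IsVar F = ∃[ p ] F ≡ var p

IsVarBot : Fm → Set
IsVarBot F = IsVar F ⊎ F ≡ falsum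

IsImp : Fm → Set
IsImp F = ∃[ A ] ∃[ B ] F ≡ (A ⊃ B)

mutual
  data Sl (G : Fm) : Fm → Set where
    l∧₁ : ∀ {A B} → Sl G (A ∧ B) → Sl G A
    l∧₂ : ∀ {A B} → Sl G (A ∧ B) → Sl G B
    l∨₁ : ∀ {A B} → Sl G (A ∨ B) → Sl G A
    l∨₂ : ∀ {A B} → Sl G (A ∨ B) → Sl G B
    l⊃  : ∀ {A B} → Sl G (A ⊃ B) → Sl G B
    r⊃  : ∀ {A B} → Sr G (A ⊃ B) → Sl G A

  data Sr (G : Fm) : Fm → Set where
    root : Sr G G
    r∧₁ : ∀ {A B} → Sr G (A ∧ B) → Sr G A
    r∧₂ : ∀ {A B} → Sr G (A ∧ B) → Sr G B
    r∨₁ : ∀ {A B} → Sr G (A ∨ B) → Sr G A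
    r∨₂ : ∀ {A B} → Sr G (A ∨ B) → Sr G B
    r⊃  : ∀ {A B} → Sr G (A ⊃ B) → Sr G B
    l⊃  : ∀ {A B} → Sl G (A ⊃ B) → Sr G A

BarAt : Fm → Fm → Set
BarAt G x = Sl G x × IsVar x

BarImp : Fm → Fm → Set
BarImp G x = Sl G x × IsImp x

Bar : Fm → Fm → Set
Bar G x = BarAt G x ⊎ BarImp G x

data Cl (Γ : Fm → Set) : Fm → Set where
  base : ∀ {X} → Γ X → Cl Γ X
  c∧   : ∀ {X Y} → Cl Γ X → Cl Γ Y → Cl Γ (X ∧ Y)
  c∨l  : ∀ {X} A → Cl Γ X → Cl Γ (A ∨ X)
  c∨r  : ∀ {X} A → Cl Γ X → Cl Γ (X ∨ A)
  c⊃   : ∀ {X} A → Cl Γ X → Cl Γ (A ⊃ X)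

-- Finite sets of formulas are represented by lists (up to set equality)

⟦_⟧ : List Fm → Fm → Set
⟦ Γ ⟧ x = x ∈ Γ

_⊆ₚ_ : List Fm → (Fm → Set) → Set
Γ ⊆ₚ P = ∀ {x} → x ∈ Γ → P x

_⊆_ : List Fm → List Fm → Set
Γ ⊆ Δ = Γ ⊆ₚ ⟦ Δ ⟧

_≐_ : List Fm → (Fm → Set) → Set
Γ ≐ P = ∀ x → (x ∈ Γ → P x) × (P x → x ∈ Γ)

_∪ₚ_ : (Fm → Set) → (Fm → Set) → Fm → Set
(P ∪ₚ Q) x = P x ⊎ Q x

_∩ₚ_ : (Fm → Set) → (Fm → Set) → Fm → Set
(P ∩ₚ Q) x = P x × Q x

∅ₚ : Fm → Set
∅ₚ _ = ⊥

data Seq : Set where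
  reg : List Fm → Fm → Seq
  irr : List Fm → List Fm → Fm → Seq -- Σ ; Θ → C

data WF (G : Fm) : Seq → Set where
  wf-reg : ∀ {Γ C} → Γ ⊆ₚ Bar G → Sr G C → WF G (reg Γ C)
  wf-irr : ∀ {Σ Θ C} → Σ ⊆ₚ Bar G → Θ ⊆ₚ Bar G → Sr G C → WF G (irr Σ Θ C)

data _⊑_ : Seq → Seq → Set where
  reg⊑ : ∀ {Γ₁ Γ₂ C} → Γ₁ ⊆ Γ₂ → reg Γ₁ C ⊑ reg Γ₂ C
  irr⊑ : ∀ {Σ₁ Σ₂ Θ₁ Θ₂ C} → Σ₁ ⊆ Σ₂ → Σ₂ ⊆ Σ₁ → Θ₁ ⊆ Θ₂ →
         irr Σ₁ Θ₁ C ⊑ irr Σ₂ Θ₂ C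

data Rule : Set where
  axReg axIrr ∧Reg ∧Irr ∨Irr ⊃∈Reg ⊃∈Irr ⊃∉ ⋈At ⋈∨ : Rule

module Join (G : Fm) (n : ℕ) (Σs Θs : Fin (suc n) → List Fm) (As : Fin (suc n) → Fm) where

  Υ : Fm → Set
  Υ Y = ∃[ j ] Y ≡ As j

  ΣAt : Fm → Set
  ΣAt x = (∃[ j ] x ∈ Σs j) × IsVar x

  ΣImp : Fm → Set
  ΣImp x = (∃[ j ] x ∈ Σs j) × IsImp x

  ΘAt : Fm → Set
  ΘAt x = (∀ j → x ∈ Θs j) × IsVar x

  ΘImp : Fm → Set
  ΘImp x = ∃[ Y ] ∃[ Z ] (x ≡ (Y ⊃ Z) × (∀ j → x ∈ Θs j) × Υ Y)

  premises : List Seq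
  premises = tabulate (λ j → irr (Σs j) (Θs j) (As j))

  side : Set
  side = (∀ i j → i ≢ j → Σs i ⊆ₚ (⟦ Σs j ⟧ ∪ₚ ⟦ Θs j ⟧))
       × (∀ Y Z → ΣImp (Y ⊃ Z) → Υ Y)

data RuleCond (G : Fm) : Rule → List Seq → Seq → Set₁ where
  axReg : ∀ {Γ F} → IsVarBot F →
    Γ ≐ (λ x → BarAt G x × x ≢ F) →
    RuleCond G axReg [] (reg Γ F)
  axIrr : ∀ {Σ Θ F} → IsVarBot F →
    Σ ≐ ∅ₚ →
    Θ ≐ (λ x → (BarAt G x × x ≢ F) ⊎ BarImp G x) →
    RuleCond G axIrr [] (irr Σ Θ F)
  ∧Reg₁ : ∀ {Γ Γ' A₁ A₂} → Γ' ≐ ⟦ Γ ⟧ →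
    RuleCond G ∧Reg (reg Γ A₁ ∷ []) (reg Γ' (A₁ ∧ A₂))
  ∧Reg₂ : ∀ {Γ Γ' A₁ A₂} → Γ' ≐ ⟦ Γ ⟧ →
    RuleCond G ∧Reg (reg Γ A₂ ∷ []) (reg Γ' (A₁ ∧ A₂))
  ∧Irr₁ : ∀ {Σ Θ Σ' Θ' A₁ A₂} → Σ' ≐ ⟦ Σ ⟧ → Θ' ≐ ⟦ Θ ⟧ →
    RuleCond G ∧Irr (irr Σ Θ A₁ ∷ []) (irr Σ' Θ' (A₁ ∧ A₂))
  ∧Irr₂ : ∀ {Σ Θ Σ' Θ' A₁ A₂} → Σ' ≐ ⟦ Σ ⟧ → Θ' ≐ ⟦ Θ ⟧ →
    RuleCond G ∧Irr (irr Σ Θ A₂ ∷ []) (irr Σ' Θ' (A₁ ∧ A₂))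
  ∨Irr : ∀ {Σ₁ Θ₁ C₁ Σ₂ Θ₂ C₂ Σ Θ} →
    Σ₁ ⊆ₚ (⟦ Σ₂ ⟧ ∪ₚ ⟦ Θ₂ ⟧) → Σ₂ ⊆ₚ (⟦ Σ₁ ⟧ ∪ₚ ⟦ Θ₁ ⟧) →
    Σ ≐ (⟦ Σ₁ ⟧ ∪ₚ ⟦ Σ₂ ⟧) → Θ ≐ (⟦ Θ₁ ⟧ ∩ₚ ⟦ Θ₂ ⟧) →
    RuleCond G ∨Irr (irr Σ₁ Θ₁ C₁ ∷ irr Σ₂ Θ₂ C₂ ∷ []) (irr Σ Θ (C₁ ∨ C₂))
  ⊃∈Reg : ∀ {Γ Γ' A B} → Γ' ≐ ⟦ Γ ⟧ → Cl ⟦ Γ ⟧ A →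
    RuleCond G ⊃∈Reg (reg Γ B ∷ []) (reg Γ' (A ⊃ B))
  ⊃∈Irr : ∀ {Σ Ξ Σ' Θ A B} (Λ : List Fm) →
    Ξ ≐ (⟦ Θ ⟧ ∪ₚ ⟦ Λ ⟧) →
    (∀ x → x ∈ Θ → x ∈ Λ → ⊥) →
    Σ' ≐ (⟦ Σ ⟧ ∪ₚ ⟦ Λ ⟧) →
    Cl (⟦ Σ ⟧ ∪ₚ ⟦ Λ ⟧) A →
    (∀ (Λ' : List Fm) → Λ' ⊆ Λ → ¬ (Λ ⊆ Λ') → ¬ Cl (⟦ Σ ⟧ ∪ₚ ⟦ Λ' ⟧) A) →
    RuleCond G ⊃∈Irr (irr Σ Ξ B ∷ []) (irr Σ' Θ (A ⊃ B))
  ⊃∉ : ∀ {Γ Σ Θ A B} →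
    Σ ≐ ∅ₚ →
    Θ ⊆ₚ (Cl ⟦ Γ ⟧ ∩ₚ Bar G) →
    Cl ⟦ Γ ⟧ A → ¬ Cl ⟦ Θ ⟧ A →
    (∀ (Θ' : List Fm) → Θ ⊆ Θ' → ¬ (Θ' ⊆ Θ) → Θ' ⊆ₚ (Cl ⟦ Γ ⟧ ∩ₚ Bar G) →
       Cl ⟦ Θ' ⟧ A) →
    RuleCond G ⊃∉ (reg Γ B ∷ []) (irr Σ Θ (A ⊃ B))
  ⋈At : ∀ {Γ F} n Σs Θs As → let open Join G n Σs Θs As in
    side →
    (∀ j → ∃[ Z ] Sl G (As j ⊃ Z)) →
    IsVarBot F → ¬ ΣAt F →
    Γ ≐ (ΣAt ∪ₚ ((λ x → ΘAt x × x ≢ F) ∪ₚ (ΣImp ∪ₚ ΘImp))) →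
    RuleCond G ⋈At premises (reg Γ F)
  ⋈∨ : ∀ {Γ C₁ C₂} n Σs Θs As → let open Join G n Σs Θs As in
    side →
    (∀ j → ∃[ Z ] (Sl G (As j ⊃ Z) ⊎ Sr G (As j ∨ Z) ⊎ Sr G (Z ∨ As j))) →
    Υ C₁ → Υ C₂ →
    Γ ≐ (ΣAt ∪ₚ (ΘAt ∪ₚ (ΣImp ∪ₚ ΘImp))) →
    RuleCond G ⋈∨ premises (reg Γ (C₁ ∨ C₂))

Instance : Fm → Rule → List Seq → Seq → Set₁
Instance G R ps σ = All (WF G) ps × WF G σ × RuleCond G R ps σ

-- Every rule of FRJ(G) builds its conclusion from its premises by operations that are
-- monotone in the Θ-parts and Γ-parts and only depend on the Σ-parts as sets (which
-- subsumption leaves unchanged), and all of its side conditions survive such an enlargement;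
-- so rebuilding the conclusion from the enlarged premises gives an instance of the same rule
-- whose conclusion subsumes the old one. The exception is ⊃∉, whose Θ must be maximal among
-- the subsets of Cl(Γ) ∩ Γ̄ not generating A: when Γ grows, the old Θ is saturated greedily
-- over the finite set Cl(Γ) ∩ Γ̄ ⊆ Sl(G), which is decidable because Sl(G) is enumerated by
-- signed subformulas.

module Submission where

open import Defs
open import Data.Nat as ℕ using (ℕ)
open import Data.Fin using (Fin; zero; suc)
open import Data.Fin.Properties using (any?; all?)
open import Data.List using (List; []; _∷_; _++_; map; filter; concat; tabulate)
open import Data.List.Membership.Propositional using (_∈_; _∉_; find)
open import Data.List.Membership.Propositional.Properties
  using (∈-++⁺ˡ; ∈-++⁺ʳ; ∈-++⁻; ∈-filter⁺; ∈-filter⁻; ∈-map⁺; ∈-concat⁺′; ∈-tabulate⁺)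
open import Data.List.Relation.Unary.Any using (here; there)
open import Data.List.Relation.Unary.All as All using (All; []; _∷_)
open import Data.List.Relation.Unary.All.Properties using (¬All⇒Any¬; tabulate⁻)
open import Data.List.Relation.Binary.Pointwise using (Pointwise; []; _∷_)
open import Data.List.Relation.Binary.Subset.Propositional.Properties using (∷⁺ʳ; ∈-∷⁺ʳ)
open import Data.Product using (Σ-syntax; ∃-syntax; _×_; _,_; proj₁; proj₂; map₁)
  renaming (map to ×-map)
open import Data.Product.Properties using (≡-dec)
open import Data.Sum using (_⊎_; inj₁; inj₂; [_,_]) renaming (map to ⊎-map)
open import Data.Empty using (⊥-elim)
open import Function using (id; _∘_)
open import Relation.Nullary using (¬_; Dec; yes; no; ¬?)
open import Relation.Nullary.Decidable using (_×-dec_; _⊎-dec_; map′)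
open import Relation.Binary.Definitions using (DecidableEquality)
open import Relation.Binary.PropositionalEquality using (_≡_; refl; cong; cong₂)
open import Relation.Unary using (Decidable)

infix 4 _≟_

_≟_ : DecidableEquality Fm
var p ≟ var q = map′ (cong var) (λ { refl → refl }) (p ℕ.≟ q)
falsum ≟ falsum = yes refl
(A ∧ B) ≟ (C ∧ D) = map′ (λ (p , q) → cong₂ _∧_ p q) (λ { refl → refl , refl }) (A ≟ C ×-dec B ≟ D)
(A ∨ B) ≟ (C ∨ D) = map′ (λ (p , q) → cong₂ _∨_ p q) (λ { refl → refl , refl }) (A ≟ C ×-dec B ≟ D)
(A ⊃ B) ≟ (C ⊃ D) = map′ (λ (p , q) → cong₂ _⊃_ p q) (λ { refl → refl , refl }) (A ≟ C ×-dec B ≟ D)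
var _ ≟ falsum = no λ ()
var _ ≟ (_ ∧ _) = no λ ()
var _ ≟ (_ ∨ _) = no λ ()
var _ ≟ (_ ⊃ _) = no λ ()
falsum ≟ var _ = no λ ()
falsum ≟ (_ ∧ _) = no λ ()
falsum ≟ (_ ∨ _) = no λ ()
falsum ≟ (_ ⊃ _) = no λ ()
(_ ∧ _) ≟ var _ = no λ ()
(_ ∧ _) ≟ falsum = no λ ()
(_ ∧ _) ≟ (_ ∨ _) = no λ ()
(_ ∧ _) ≟ (_ ⊃ _) = no λ ()
(_ ∨ _) ≟ var _ = no λ ()
(_ ∨ _) ≟ falsum = no λ ()
(_ ∨ _) ≟ (_ ∧ _) = no λ ()
(_ ∨ _) ≟ (_ ⊃ _) = no λ ()
(_ ⊃ _) ≟ var _ = no λ ()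
(_ ⊃ _) ≟ falsum = no λ ()
(_ ⊃ _) ≟ (_ ∧ _) = no λ ()
(_ ⊃ _) ≟ (_ ∨ _) = no λ ()

open import Data.List.Membership.DecPropositional _≟_ using (_∈?_)

isVar? : Decidable IsVar
isVar? (var p) = yes (p , refl)
isVar? falsum = no λ ()
isVar? (_ ∧ _) = no λ ()
isVar? (_ ∨ _) = no λ ()
isVar? (_ ⊃ _) = no λ ()

isImp? : Decidable IsImp
isImp? (A ⊃ B) = yes (A , B , refl)
isImp? (var _) = no λ ()
isImp? falsum = no λ ()
isImp? (_ ∧ _) = no λ ()
isImp? (_ ∨ _) = no λ ()

Cl-mono : ∀ {P Q : Fm → Set} → (∀ {x} → P x → Q x) → ∀ {X} → Cl P X → Cl Q X
Cl-mono P⊆Q (base p) = base (P⊆Q p)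
Cl-mono P⊆Q (c∧ X Y) = c∧ (Cl-mono P⊆Q X) (Cl-mono P⊆Q Y)
Cl-mono P⊆Q (c∨l A X) = c∨l A (Cl-mono P⊆Q X)
Cl-mono P⊆Q (c∨r A X) = c∨r A (Cl-mono P⊆Q X)
Cl-mono P⊆Q (c⊃ A X) = c⊃ A (Cl-mono P⊆Q X)

Cl? : ∀ {P : Fm → Set} → Decidable P → Decidable (Cl P)
Cl? P? X with P? X
... | yes p = yes (base p)
Cl? P? (var _) | no ¬p = no λ { (base p) → ¬p p }
Cl? P? falsum | no ¬p = no λ { (base p) → ¬p p }
Cl? P? (X ∧ Y) | no ¬p with Cl? P? X | Cl? P? Y
... | yes x | yes y = yes (c∧ x y)
... | no ¬x | _ = no λ { (base p) → ¬p p ; (c∧ x _) → ¬x x }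
... | _ | no ¬y = no λ { (base p) → ¬p p ; (c∧ _ y) → ¬y y }
Cl? P? (X ∨ Y) | no ¬p with Cl? P? X | Cl? P? Y
... | _ | yes y = yes (c∨l X y)
... | yes x | _ = yes (c∨r Y x)
... | no ¬x | no ¬y = no λ { (base p) → ¬p p ; (c∨l _ y) → ¬y y ; (c∨r _ x) → ¬x x }
Cl? P? (X ⊃ Y) | no ¬p with Cl? P? Y
... | yes y = yes (c⊃ X y)
... | no ¬y = no λ { (base p) → ¬p p ; (c⊃ _ y) → ¬y y }

data Side : Set where
  left right : Side

opposite : Side → Side
opposite left = right
opposite right = left

_≟ˢ_ : DecidableEquality Side
left ≟ˢ left = yes refl
left ≟ˢ right = no λ ()
right ≟ˢ left = no λ ()
right ≟ˢ right = yes refl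

open import Data.List.Membership.DecPropositional (≡-dec _≟ˢ_ _≟_) using () renaming (_∈?_ to _∈ˢ?_)

Sub : Fm → Side → Fm → Set
Sub G left = Sl G
Sub G right = Sr G

-- signed s F lists the subformulas of F, each tagged with the side it lands on (left for
-- Sl, right for Sr) when F itself is on side s.
mutual
  signed : Side → Fm → List (Side × Fm)
  signed s F = (s , F) ∷ signedParts s F

  signedParts : Side → Fm → List (Side × Fm)
  signedParts s (A ∧ B) = signed s A ++ signed s B
  signedParts s (A ∨ B) = signed s A ++ signed s B
  signedParts s (A ⊃ B) = signed s B ++ signed (opposite s) A
  signedParts s _ = []

signed-sound : ∀ {G s F t x} → (t , x) ∈ signed s F → Sub G s F → Sub G t x
signed-sound (here refl) h = h
signed-sound {s = left} {A ∧ B} (there m) h =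
  [ (λ m → signed-sound m (l∧₁ h)) , (λ m → signed-sound m (l∧₂ h)) ] (∈-++⁻ (signed left A) m)
signed-sound {s = right} {A ∧ B} (there m) h =
  [ (λ m → signed-sound m (r∧₁ h)) , (λ m → signed-sound m (r∧₂ h)) ] (∈-++⁻ (signed right A) m)
signed-sound {s = left} {A ∨ B} (there m) h =
  [ (λ m → signed-sound m (l∨₁ h)) , (λ m → signed-sound m (l∨₂ h)) ] (∈-++⁻ (signed left A) m)
signed-sound {s = right} {A ∨ B} (there m) h =
  [ (λ m → signed-sound m (r∨₁ h)) , (λ m → signed-sound m (r∨₂ h)) ] (∈-++⁻ (signed right A) m)
signed-sound {s = left} {A ⊃ B} (there m) h =
  [ (λ m → signed-sound m (Sl.l⊃ h)) , (λ m → signed-sound m (Sr.l⊃ h)) ] (∈-++⁻ (signed left B) m)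
signed-sound {s = right} {A ⊃ B} (there m) h =
  [ (λ m → signed-sound m (Sr.r⊃ h)) , (λ m → signed-sound m (Sl.r⊃ h)) ] (∈-++⁻ (signed right B) m)

signed-trans : ∀ {s F t x} → (t , x) ∈ signed s F → ∀ {y} → y ∈ signed t x → y ∈ signed s F
signed-trans (here refl) m = m
signed-trans {s} {A ∧ B} (there m₀) m with ∈-++⁻ (signed s A) m₀
... | inj₁ m₁ = there (∈-++⁺ˡ (signed-trans m₁ m))
... | inj₂ m₂ = there (∈-++⁺ʳ (signed s A) (signed-trans m₂ m))
signed-trans {s} {A ∨ B} (there m₀) m with ∈-++⁻ (signed s A) m₀
... | inj₁ m₁ = there (∈-++⁺ˡ (signed-trans m₁ m))
... | inj₂ m₂ = there (∈-++⁺ʳ (signed s A) (signed-trans m₂ m))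
signed-trans {s} {A ⊃ B} (there m₀) m with ∈-++⁻ (signed s B) m₀
... | inj₁ m₁ = there (∈-++⁺ˡ (signed-trans m₁ m))
... | inj₂ m₂ = there (∈-++⁺ʳ (signed s B) (signed-trans m₂ m))

mutual
  Sl⇒signed : ∀ {G x} → Sl G x → (left , x) ∈ signed right G
  Sl⇒signed (l∧₁ h) = signed-trans (Sl⇒signed h) (there (here refl))
  Sl⇒signed (l∧₂ {A} h) = signed-trans (Sl⇒signed h) (there (∈-++⁺ʳ (signed left A) (here refl)))
  Sl⇒signed (l∨₁ h) = signed-trans (Sl⇒signed h) (there (here refl))
  Sl⇒signed (l∨₂ {A} h) = signed-trans (Sl⇒signed h) (there (∈-++⁺ʳ (signed left A) (here refl)))
  Sl⇒signed (Sl.l⊃ h) = signed-trans (Sl⇒signed h) (there (here refl))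
  Sl⇒signed (Sl.r⊃ {B = B} h) = signed-trans (Sr⇒signed h) (there (∈-++⁺ʳ (signed right B) (here refl)))

  Sr⇒signed : ∀ {G x} → Sr G x → (right , x) ∈ signed right G
  Sr⇒signed root = here refl
  Sr⇒signed (r∧₁ h) = signed-trans (Sr⇒signed h) (there (here refl))
  Sr⇒signed (r∧₂ {A} h) = signed-trans (Sr⇒signed h) (there (∈-++⁺ʳ (signed right A) (here refl)))
  Sr⇒signed (r∨₁ h) = signed-trans (Sr⇒signed h) (there (here refl))
  Sr⇒signed (r∨₂ {A} h) = signed-trans (Sr⇒signed h) (there (∈-++⁺ʳ (signed right A) (here refl)))
  Sr⇒signed (Sr.r⊃ h) = signed-trans (Sr⇒signed h) (there (here refl))
  Sr⇒signed (Sr.l⊃ {B = B} h) = signed-trans (Sl⇒signed h) (there (∈-++⁺ʳ (signed left B) (here refl)))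

Sl? : ∀ G → Decidable (Sl G)
Sl? G x = map′ (λ m → signed-sound m root) Sl⇒signed ((left , x) ∈ˢ? signed right G)

subformulas : Fm → List Fm
subformulas G = map proj₂ (signed right G)

Sl⇒∈subformulas : ∀ {G x} → Sl G x → x ∈ subformulas G
Sl⇒∈subformulas h = ∈-map⁺ proj₂ (Sl⇒signed h)

Bar? : ∀ G → Decidable (Bar G)
Bar? G x = (Sl? G x ×-dec isVar? x) ⊎-dec (Sl? G x ×-dec isImp? x)

Bar⇒Sl : ∀ {G x} → Bar G x → Sl G x
Bar⇒Sl = [ proj₁ , proj₁ ]

≐-refl : ∀ Γ → Γ ≐ ⟦ Γ ⟧
≐-refl Γ x = id , id

≐-sound : ∀ {Γ P} → Γ ≐ P → Γ ⊆ₚ P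
≐-sound Γ≐P = proj₁ (Γ≐P _)

≐-complete : ∀ {Γ P} → Γ ≐ P → ∀ {x} → P x → x ∈ Γ
≐-complete Γ≐P = proj₂ (Γ≐P _)

≐-⊆ : ∀ {Γ Δ P Q} → Γ ≐ P → Δ ≐ Q → (∀ {x} → P x → Q x) → Γ ⊆ Δ
≐-⊆ Γ≐P Δ≐Q P⊆Q = ≐-complete Δ≐Q ∘ P⊆Q ∘ ≐-sound Γ≐P

filter-≐ : ∀ {P : Fm → Set} (P? : Decidable P) xs → filter P? xs ≐ (⟦ xs ⟧ ∩ₚ P)
filter-≐ P? xs x = ∈-filter⁻ P? , λ (x∈xs , p) → ∈-filter⁺ P? x∈xs p

filter-covering-≐ : ∀ {P : Fm → Set} (P? : Decidable P) {xs} →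
  (∀ {x} → P x → x ∈ xs) → filter P? xs ≐ P
filter-covering-≐ P? {xs} covered x =
  proj₂ ∘ ≐-sound (filter-≐ P? xs) , λ p → ≐-complete (filter-≐ P? xs) (covered p , p)

++-≐ : ∀ {xs ys} → (xs ++ ys) ≐ (⟦ xs ⟧ ∪ₚ ⟦ ys ⟧)
++-≐ {xs} x = ∈-++⁻ xs , [ ∈-++⁺ˡ , ∈-++⁺ʳ xs ]

_∩_ : List Fm → List Fm → List Fm
xs ∩ ys = filter (_∈? ys) xs

∩-≐ : ∀ {xs ys} → (xs ∩ ys) ≐ (⟦ xs ⟧ ∩ₚ ⟦ ys ⟧)
∩-≐ {xs} {ys} = filter-≐ (_∈? ys) xs

_∖_ : List Fm → List Fm → List Fm
xs ∖ ys = filter (λ x → ¬? (x ∈? ys)) xs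

∖-≐ : ∀ {xs ys} → (xs ∖ ys) ≐ (λ x → x ∈ xs × x ∉ ys)
∖-≐ {xs} {ys} = filter-≐ (λ x → ¬? (x ∈? ys)) xs

∖-∪-≐ : ∀ {xs ys} → ys ⊆ xs → xs ≐ (⟦ xs ∖ ys ⟧ ∪ₚ ⟦ ys ⟧)
∖-∪-≐ {xs} {ys} ys⊆xs x = split (x ∈? ys) , [ proj₁ ∘ ≐-sound ∖-≐ , ys⊆xs ]
  where
    split : Dec (x ∈ ys) → x ∈ xs → x ∈ xs ∖ ys ⊎ x ∈ ys
    split (yes x∈ys) _ = inj₂ x∈ys
    split (no x∉ys) x∈xs = inj₁ (≐-complete ∖-≐ (x∈xs , x∉ys))

⊈⇒∃∉ : ∀ {xs ys} → ¬ xs ⊆ ys → ∃[ x ] (x ∈ xs × x ∉ ys)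
⊈⇒∃∉ {xs} {ys} xs⊈ys = find (¬All⇒Any¬ (_∈? ys) xs (xs⊈ys ∘ All.lookup))

module Saturation (Q : List Fm → Set) (Q? : ∀ Θ → Dec (Q Θ))
                  (Q-mono : ∀ {Θ Θ'} → Θ ⊆ Θ' → Q Θ → Q Θ') where

  record Saturated (Θ cs : List Fm) : Set where
    field
      Θ⁺ : List Fm
      extends : Θ ⊆ Θ⁺
      drawn-from : Θ⁺ ⊆ₚ (⟦ Θ ⟧ ∪ₚ ⟦ cs ⟧)
      avoids : ¬ Q Θ⁺
      saturated : ∀ {c} → c ∈ cs → c ∈ Θ⁺ ⊎ Q (c ∷ Θ⁺)

    maximal : ∀ Θ' → Θ⁺ ⊆ Θ' → ¬ Θ' ⊆ Θ⁺ → Θ' ⊆ cs → Q Θ'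
    maximal Θ' Θ⁺⊆Θ' Θ'⊈Θ⁺ Θ'⊆cs with ⊈⇒∃∉ Θ'⊈Θ⁺
    ... | x , x∈Θ' , x∉Θ⁺ with saturated (Θ'⊆cs x∈Θ')
    ...   | inj₁ x∈Θ⁺ = ⊥-elim (x∉Θ⁺ x∈Θ⁺)
    ...   | inj₂ q = Q-mono (∈-∷⁺ʳ x∈Θ' Θ⁺⊆Θ') q

  saturate : ∀ Θ cs → ¬ Q Θ → Saturated Θ cs
  saturate Θ [] ¬q = record
    { Θ⁺ = Θ ; extends = id ; drawn-from = inj₁ ; avoids = ¬q ; saturated = λ () }
  saturate Θ (c ∷ cs) ¬q with Q? (c ∷ Θ)
  ... | yes q = record
    { Θ⁺ = Θ⁺ ; extends = extends ; drawn-from = ⊎-map id there ∘ drawn-from ; avoids = avoids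
    ; saturated = λ { (here refl) → inj₂ (Q-mono (∷⁺ʳ c extends) q)
                    ; (there m) → saturated m } }
    where open Saturated (saturate Θ cs ¬q)
  ... | no ¬q' = record
    { Θ⁺ = Θ⁺ ; extends = extends ∘ there ; drawn-from = regroup ∘ drawn-from ; avoids = avoids
    ; saturated = λ { (here refl) → inj₁ (extends (here refl)) ; (there m) → saturated m } }
    where
      open Saturated (saturate (c ∷ Θ) cs ¬q')
      regroup : ∀ {x} → x ∈ c ∷ Θ ⊎ x ∈ cs → x ∈ Θ ⊎ x ∈ c ∷ cs
      regroup (inj₁ (here refl)) = inj₂ (here refl)
      regroup (inj₁ (there m)) = inj₁ m
      regroup (inj₂ m) = inj₂ (there m)

⊑-refl : ∀ σ → σ ⊑ σ
⊑-refl (reg Γ C) = reg⊑ id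
⊑-refl (irr Σ Θ C) = irr⊑ id id id

SubsumingInstance : Fm → Rule → List Seq → Seq → Set₁
SubsumingInstance G R ps' σ = Σ[ σ' ∈ Seq ] (Instance G R ps' σ' × σ ⊑ σ')

Monotone : Fm → Rule → Set₁
Monotone G R = ∀ {ps σ ps'} → WF G σ → RuleCond G R ps σ →
  All (WF G) ps' → Pointwise _⊑_ ps ps' → SubsumingInstance G R ps' σ

axReg-monotone : ∀ {G} → Monotone G axReg
axReg-monotone wf rule@(axReg _ _) [] [] = _ , ([] , wf , rule) , ⊑-refl _

axIrr-monotone : ∀ {G} → Monotone G axIrr
axIrr-monotone wf rule@(axIrr _ _ _) [] [] = _ , ([] , wf , rule) , ⊑-refl _

context-preserving-reg : ∀ {G R Γ Γ' Γ₂ A C} → Γ' ≐ ⟦ Γ ⟧ → Γ ⊆ Γ₂ → Sr G C → WF G (reg Γ₂ A) →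
  RuleCond G R (reg Γ₂ A ∷ []) (reg Γ₂ C) → SubsumingInstance G R (reg Γ₂ A ∷ []) (reg Γ' C)
context-preserving-reg Γ'≐Γ Γ⊆Γ₂ sr w@(wf-reg bar _) rule =
  _ , (w ∷ [] , wf-reg bar sr , rule) , reg⊑ (Γ⊆Γ₂ ∘ ≐-sound Γ'≐Γ)

context-preserving-irr : ∀ {G R Σ Θ Σ' Θ' Σ₂ Θ₂ A C} → Σ' ≐ ⟦ Σ ⟧ → Θ' ≐ ⟦ Θ ⟧ →
  irr Σ Θ A ⊑ irr Σ₂ Θ₂ A → Sr G C → WF G (irr Σ₂ Θ₂ A) →
  RuleCond G R (irr Σ₂ Θ₂ A ∷ []) (irr Σ₂ Θ₂ C) → SubsumingInstance G R (irr Σ₂ Θ₂ A ∷ []) (irr Σ' Θ' C)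
context-preserving-irr Σ'≐Σ Θ'≐Θ (irr⊑ Σ⊆Σ₂ Σ₂⊆Σ Θ⊆Θ₂) sr w@(wf-irr Σ-bar Θ-bar _) rule =
  _ , (w ∷ [] , wf-irr Σ-bar Θ-bar sr , rule) ,
  irr⊑ (Σ⊆Σ₂ ∘ ≐-sound Σ'≐Σ) (≐-complete Σ'≐Σ ∘ Σ₂⊆Σ) (Θ⊆Θ₂ ∘ ≐-sound Θ'≐Θ)

∧Reg-monotone : ∀ {G} → Monotone G ∧Reg
∧Reg-monotone (wf-reg _ sr) (∧Reg₁ Γ'≐Γ) (w ∷ []) (reg⊑ Γ⊆Γ₂ ∷ []) =
  context-preserving-reg Γ'≐Γ Γ⊆Γ₂ sr w (∧Reg₁ (≐-refl _))
∧Reg-monotone (wf-reg _ sr) (∧Reg₂ Γ'≐Γ) (w ∷ []) (reg⊑ Γ⊆Γ₂ ∷ []) =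
  context-preserving-reg Γ'≐Γ Γ⊆Γ₂ sr w (∧Reg₂ (≐-refl _))

∧Irr-monotone : ∀ {G} → Monotone G ∧Irr
∧Irr-monotone (wf-irr _ _ sr) (∧Irr₁ Σ'≐Σ Θ'≐Θ) (w ∷ []) (s@(irr⊑ _ _ _) ∷ []) =
  context-preserving-irr Σ'≐Σ Θ'≐Θ s sr w (∧Irr₁ (≐-refl _) (≐-refl _))
∧Irr-monotone (wf-irr _ _ sr) (∧Irr₂ Σ'≐Σ Θ'≐Θ) (w ∷ []) (s@(irr⊑ _ _ _) ∷ []) =
  context-preserving-irr Σ'≐Σ Θ'≐Θ s sr w (∧Irr₂ (≐-refl _) (≐-refl _))

⊃∈Reg-monotone : ∀ {G} → Monotone G ⊃∈Reg
⊃∈Reg-monotone (wf-reg _ sr) (⊃∈Reg Γ'≐Γ A∈ClΓ) (w ∷ []) (reg⊑ Γ⊆Γ₂ ∷ []) =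
  context-preserving-reg Γ'≐Γ Γ⊆Γ₂ sr w (⊃∈Reg (≐-refl _) (Cl-mono Γ⊆Γ₂ A∈ClΓ))

∨Irr-monotone : ∀ {G} → Monotone G ∨Irr
∨Irr-monotone (wf-irr _ _ sr) (∨Irr {C₁ = C₁} {C₂ = C₂} Σ₁⊆ Σ₂⊆ Σ≐ Θ≐)
  (w₁@(wf-irr Σ₁'-bar Θ₁'-bar _) ∷ w₂@(wf-irr Σ₂'-bar _ _) ∷ [])
  (irr⊑ {Σ₂ = Σ₁'} {Θ₂ = Θ₁'} Σ₁⊆Σ₁' Σ₁'⊆Σ₁ Θ₁⊆Θ₁' ∷
   irr⊑ {Σ₂ = Σ₂'} {Θ₂ = Θ₂'} Σ₂⊆Σ₂' Σ₂'⊆Σ₂ Θ₂⊆Θ₂' ∷ []) =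
  irr (Σ₁' ++ Σ₂') (Θ₁' ∩ Θ₂') (C₁ ∨ C₂) ,
  (w₁ ∷ w₂ ∷ [] , wf-irr ([ Σ₁'-bar , Σ₂'-bar ] ∘ ∈-++⁻ Σ₁') (Θ₁'-bar ∘ proj₁ ∘ ≐-sound ∩-≐) sr ,
   ∨Irr (⊎-map Σ₂⊆Σ₂' Θ₂⊆Θ₂' ∘ Σ₁⊆ ∘ Σ₁'⊆Σ₁) (⊎-map Σ₁⊆Σ₁' Θ₁⊆Θ₁' ∘ Σ₂⊆ ∘ Σ₂'⊆Σ₂)
        ++-≐ ∩-≐) ,
  irr⊑ (≐-⊆ Σ≐ ++-≐ (⊎-map Σ₁⊆Σ₁' Σ₂⊆Σ₂')) (≐-⊆ ++-≐ Σ≐ (⊎-map Σ₁'⊆Σ₁ Σ₂'⊆Σ₂))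
       (≐-⊆ Θ≐ ∩-≐ (×-map Θ₁⊆Θ₁' Θ₂⊆Θ₂'))

⊃∈Irr-monotone : ∀ {G} → Monotone G ⊃∈Irr
⊃∈Irr-monotone (wf-irr _ _ sr) (⊃∈Irr {A = A} {B} Λ Ξ≐Θ∪Λ Θ∩Λ=∅ Σ'≐Σ∪Λ A∈Cl minimal)
  (w@(wf-irr Σ₂-bar Ξ₂-bar _) ∷ []) (irr⊑ {Σ₂ = Σ₂} {Θ₂ = Ξ₂} Σ⊆Σ₂ Σ₂⊆Σ Ξ⊆Ξ₂ ∷ []) =
  irr (Σ₂ ++ Λ) (Ξ₂ ∖ Λ) (A ⊃ B) ,
  (w ∷ [] , wf-irr ([ Σ₂-bar , Ξ₂-bar ∘ Λ⊆Ξ₂ ] ∘ ∈-++⁻ Σ₂) (Ξ₂-bar ∘ proj₁ ∘ ≐-sound ∖-≐) sr ,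
   ⊃∈Irr Λ (∖-∪-≐ Λ⊆Ξ₂) (λ x m → proj₂ (≐-sound (∖-≐ {Ξ₂}) m)) ++-≐
     (Cl-mono (⊎-map Σ⊆Σ₂ id) A∈Cl)
     (λ Λ' Λ'⊆Λ Λ⊈Λ' → minimal Λ' Λ'⊆Λ Λ⊈Λ' ∘ Cl-mono (⊎-map Σ₂⊆Σ id))) ,
  irr⊑ (≐-⊆ Σ'≐Σ∪Λ ++-≐ (⊎-map Σ⊆Σ₂ id)) (≐-⊆ ++-≐ Σ'≐Σ∪Λ (⊎-map Σ₂⊆Σ id))
       (λ {x} x∈Θ → ≐-complete ∖-≐ (Ξ⊆Ξ₂ (≐-complete Ξ≐Θ∪Λ (inj₁ x∈Θ)) , Θ∩Λ=∅ x x∈Θ))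
  where
    Λ⊆Ξ₂ : Λ ⊆ Ξ₂
    Λ⊆Ξ₂ = Ξ⊆Ξ₂ ∘ ≐-complete Ξ≐Θ∪Λ ∘ inj₂

⊃∉-monotone : ∀ {G} → Monotone G ⊃∉
⊃∉-monotone {G} (wf-irr Σ-bar _ sr) (⊃∉ {Θ = Θ} {A} Σ≐∅ Θ-bounded A∈ClΓ A∉ClΘ _)
  (w@(wf-reg _ _) ∷ []) (reg⊑ {Γ₂ = Γ₂} Γ⊆Γ₂ ∷ []) =
  irr _ Θ⁺ _ , (w ∷ [] , wf-irr Σ-bar (proj₂ ∘ Θ⁺-bounded) sr ,
                ⊃∉ Σ≐∅ Θ⁺-bounded (Cl-mono Γ⊆Γ₂ A∈ClΓ) avoids
                   (λ Θ' Θ⁺⊆Θ' Θ'⊈Θ⁺ Θ'-bounded →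
                      maximal Θ' Θ⁺⊆Θ' Θ'⊈Θ⁺ (≐-complete bounded-≐ ∘ Θ'-bounded))) ,
  irr⊑ id id extends
  where
    Bounded : Fm → Set
    Bounded = Cl ⟦ Γ₂ ⟧ ∩ₚ Bar G

    bounded? : Decidable Bounded
    bounded? x = Cl? (_∈? Γ₂) x ×-dec Bar? G x

    bounded : List Fm
    bounded = filter bounded? (subformulas G)

    bounded-≐ : bounded ≐ Bounded
    bounded-≐ = filter-covering-≐ bounded? (Sl⇒∈subformulas ∘ Bar⇒Sl ∘ proj₂)

    open Saturation (λ Θ → Cl ⟦ Θ ⟧ A) (λ Θ → Cl? (_∈? Θ) A) (λ Θ⊆Θ' → Cl-mono Θ⊆Θ')
    open Saturated (saturate Θ bounded A∉ClΘ)

    Θ⁺-bounded : Θ⁺ ⊆ₚ Bounded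
    Θ⁺-bounded = [ ×-map (Cl-mono Γ⊆Γ₂) id ∘ Θ-bounded , ≐-sound bounded-≐ ] ∘ drawn-from

irr⊑⇒Σ⊆ : ∀ {Σ₁ Σ₂ Θ₁ Θ₂ C} → irr Σ₁ Θ₁ C ⊑ irr Σ₂ Θ₂ C → Σ₁ ⊆ Σ₂
irr⊑⇒Σ⊆ (irr⊑ Σ₁⊆Σ₂ _ _) = Σ₁⊆Σ₂

irr⊑⇒Σ⊇ : ∀ {Σ₁ Σ₂ Θ₁ Θ₂ C} → irr Σ₁ Θ₁ C ⊑ irr Σ₂ Θ₂ C → Σ₂ ⊆ Σ₁
irr⊑⇒Σ⊇ (irr⊑ _ Σ₂⊆Σ₁ _) = Σ₂⊆Σ₁

irr⊑⇒Θ⊆ : ∀ {Σ₁ Σ₂ Θ₁ Θ₂ C} → irr Σ₁ Θ₁ C ⊑ irr Σ₂ Θ₂ C → Θ₁ ⊆ Θ₂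
irr⊑⇒Θ⊆ (irr⊑ _ _ Θ₁⊆Θ₂) = Θ₁⊆Θ₂

join-premises-subsumed : ∀ {m} {Σs Θs : Fin m → List Fm} {As : Fin m → Fm} {ps'} →
  Pointwise _⊑_ (tabulate (λ j → irr (Σs j) (Θs j) (As j))) ps' →
  Σ[ Σs' ∈ (Fin m → List Fm) ] Σ[ Θs' ∈ (Fin m → List Fm) ]
    (ps' ≡ tabulate (λ j → irr (Σs' j) (Θs' j) (As j)) ×
     (∀ j → irr (Σs j) (Θs j) (As j) ⊑ irr (Σs' j) (Θs' j) (As j)))
join-premises-subsumed {ℕ.zero} [] = (λ ()) , (λ ()) , refl , λ ()
join-premises-subsumed {ℕ.suc m} (s@(irr⊑ {Σ₂ = Σ'} {Θ₂ = Θ'} _ _ _) ∷ rest)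
  with join-premises-subsumed rest
... | Σs' , Θs' , refl , ⊑s =
  (λ { zero → Σ' ; (suc j) → Σs' j }) , (λ { zero → Θ' ; (suc j) → Θs' j }) , refl ,
  λ { zero → s ; (suc j) → ⊑s j }

module JoinDecidable (G : Fm) (n : ℕ) (Σs Θs : Fin (ℕ.suc n) → List Fm) (As : Fin (ℕ.suc n) → Fm) where
  open Join G n Σs Θs As

  InΣ InΘ : Fm → Set
  InΣ x = ∃[ j ] x ∈ Σs j
  InΘ x = ∀ j → x ∈ Θs j

  InΣ? : Decidable InΣ
  InΣ? x = any? (λ j → x ∈? Σs j)

  InΘ? : Decidable InΘ
  InΘ? x = all? (λ j → x ∈? Θs j)

  Υ? : Decidable Υ
  Υ? Y = any? (λ j → Y ≟ As j)

  ΣAt? : Decidable ΣAt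
  ΣAt? x = InΣ? x ×-dec isVar? x

  ΣImp? : Decidable ΣImp
  ΣImp? x = InΣ? x ×-dec isImp? x

  ΘAt? : Decidable ΘAt
  ΘAt? x = InΘ? x ×-dec isVar? x

  ΘImp? : Decidable ΘImp
  ΘImp? (Y ⊃ Z) = map′ (λ (h , u) → Y , Z , refl , h , u) (λ { (_ , _ , refl , h , u) → h , u })
                       (InΘ? (Y ⊃ Z) ×-dec Υ? Y)
  ΘImp? (var _) = no λ { (_ , _ , () , _) }
  ΘImp? falsum = no λ { (_ , _ , () , _) }
  ΘImp? (_ ∧ _) = no λ { (_ , _ , () , _) }
  ΘImp? (_ ∨ _) = no λ { (_ , _ , () , _) }

  ΘImp⇒InΘ : ∀ {x} → ΘImp x → InΘ x
  ΘImp⇒InΘ (_ , _ , _ , h , _) = h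

  support : List Fm
  support = concat (tabulate Σs) ++ Θs zero

  InΣ⇒support : ∀ {x} → InΣ x → x ∈ support
  InΣ⇒support (j , x∈Σs) = ∈-++⁺ˡ (∈-concat⁺′ x∈Σs (∈-tabulate⁺ {f = Σs} j))

  InΘ⇒support : ∀ {x} → InΘ x → x ∈ support
  InΘ⇒support x∈Θs = ∈-++⁺ʳ (concat (tabulate Σs)) (x∈Θs zero)

module JoinSubsumption (G : Fm) (n : ℕ) (Σs Θs Σs' Θs' : Fin (ℕ.suc n) → List Fm)
  (As : Fin (ℕ.suc n) → Fm)
  (⊑s : ∀ j → irr (Σs j) (Θs j) (As j) ⊑ irr (Σs' j) (Θs' j) (As j))
  (wfs : ∀ j → WF G (irr (Σs' j) (Θs' j) (As j))) where

  module J = JoinDecidable G n Σs Θs As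
  module J' = JoinDecidable G n Σs' Θs' As
  open Join G n Σs Θs As
  open Join G n Σs' Θs' As using ()
    renaming (ΣAt to ΣAt'; ΣImp to ΣImp'; ΘAt to ΘAt'; ΘImp to ΘImp'; side to side')
  open J' using (ΘAt?) public

  InΣ⁺ : ∀ {x} → J.InΣ x → J'.InΣ x
  InΣ⁺ (j , m) = j , irr⊑⇒Σ⊆ (⊑s j) m

  InΣ⁻ : ∀ {x} → J'.InΣ x → J.InΣ x
  InΣ⁻ (j , m) = j , irr⊑⇒Σ⊇ (⊑s j) m

  InΘ⁺ : ∀ {x} → J.InΘ x → J'.InΘ x
  InΘ⁺ h j = irr⊑⇒Θ⊆ (⊑s j) (h j)

  InΣ-bar : ∀ {x} → J'.InΣ x → Bar G x
  InΣ-bar (j , m) with wfs j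
  ... | wf-irr Σ-bar _ _ = Σ-bar m

  InΘ-bar : ∀ {x} → J'.InΘ x → Bar G x
  InΘ-bar h with wfs zero
  ... | wf-irr _ Θ-bar _ = Θ-bar (h zero)

  ΣAt⁺ : ∀ {x} → ΣAt x → ΣAt' x
  ΣAt⁺ = map₁ InΣ⁺

  ΣAt⁻ : ∀ {x} → ΣAt' x → ΣAt x
  ΣAt⁻ = map₁ InΣ⁻

  ΘAt⁺ : ∀ {x} → ΘAt x → ΘAt' x
  ΘAt⁺ = map₁ InΘ⁺

  side-mono : side → side'
  side-mono (Σ-shared , Σ-imp) =
    (λ i j i≢j → ⊎-map (irr⊑⇒Σ⊆ (⊑s j)) (irr⊑⇒Θ⊆ (⊑s j)) ∘ Σ-shared i j i≢j ∘ irr⊑⇒Σ⊇ (⊑s i)) ,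
    (λ Y Z → Σ-imp Y Z ∘ map₁ InΣ⁻)

  join-context : ∀ {Γ} {T T' : Fm → Set} →
    Decidable T' → (∀ {x} → T x → T' x) → (∀ {x} → T' x → ΘAt' x) →
    Γ ≐ (ΣAt ∪ₚ (T ∪ₚ (ΣImp ∪ₚ ΘImp))) →
    Σ[ Γ' ∈ List Fm ] (Γ' ≐ (ΣAt' ∪ₚ (T' ∪ₚ (ΣImp' ∪ₚ ΘImp'))) × Γ' ⊆ₚ Bar G × Γ ⊆ Γ')
  join-context {T' = T'} T'? T⇒T' T'⇒ΘAt' Γ≐ =
    filter P'? J'.support , P'≐ , P'-elim InΣ-bar InΘ-bar ∘ ≐-sound P'≐ ,
    ≐-⊆ Γ≐ P'≐ (⊎-map ΣAt⁺ (⊎-map T⇒T' (⊎-map (map₁ InΣ⁺) ΘImp⁺)))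
    where
      P' : Fm → Set
      P' = ΣAt' ∪ₚ (T' ∪ₚ (ΣImp' ∪ₚ ΘImp'))

      P'? : Decidable P'
      P'? x = J'.ΣAt? x ⊎-dec (T'? x ⊎-dec (J'.ΣImp? x ⊎-dec J'.ΘImp? x))

      P'-elim : ∀ {Q : Fm → Set} →
        (∀ {x} → J'.InΣ x → Q x) → (∀ {x} → J'.InΘ x → Q x) → ∀ {x} → P' x → Q x
      P'-elim inΣ inΘ = [ inΣ ∘ proj₁ , [ inΘ ∘ proj₁ ∘ T'⇒ΘAt' , [ inΣ ∘ proj₁ , inΘ ∘ J'.ΘImp⇒InΘ ] ] ]

      P'≐ : filter P'? J'.support ≐ P'
      P'≐ = filter-covering-≐ P'? (P'-elim J'.InΣ⇒support J'.InΘ⇒support)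

      ΘImp⁺ : ∀ {x} → ΘImp x → ΘImp' x
      ΘImp⁺ (Y , Z , x≡Y⊃Z , h , Υ-Y) = Y , Z , x≡Y⊃Z , InΘ⁺ h , Υ-Y

⋈At-monotone : ∀ {G} → Monotone G ⋈At
⋈At-monotone {G} (wf-reg _ sr) (⋈At {F = F} n Σs Θs As side hasImp F-atom F∉ΣAt Γ≐) wfs ⊑s
  with join-premises-subsumed {Σs = Σs} {Θs} {As} ⊑s
... | Σs' , Θs' , refl , ⊑s' =
  let open JoinSubsumption G n Σs Θs Σs' Θs' As ⊑s' (tabulate⁻ wfs)
      Γ' , Γ'≐ , Γ'-bar , Γ⊆Γ' = join-context (λ x → ΘAt? x ×-dec ¬? (x ≟ F)) (map₁ ΘAt⁺) proj₁ Γ≐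
  in reg Γ' F ,
     (wfs , wf-reg Γ'-bar sr , ⋈At n Σs' Θs' As (side-mono side) hasImp F-atom (F∉ΣAt ∘ ΣAt⁻) Γ'≐) ,
     reg⊑ Γ⊆Γ'

⋈∨-monotone : ∀ {G} → Monotone G ⋈∨
⋈∨-monotone {G} (wf-reg _ sr) (⋈∨ {C₁ = C₁} {C₂} n Σs Θs As side hasPartner Υ-C₁ Υ-C₂ Γ≐) wfs ⊑s
  with join-premises-subsumed {Σs = Σs} {Θs} {As} ⊑s
... | Σs' , Θs' , refl , ⊑s' =
  let open JoinSubsumption G n Σs Θs Σs' Θs' As ⊑s' (tabulate⁻ wfs)
      Γ' , Γ'≐ , Γ'-bar , Γ⊆Γ' = join-context ΘAt? ΘAt⁺ id Γ≐
  in reg Γ' (C₁ ∨ C₂) ,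
     (wfs , wf-reg Γ'-bar sr , ⋈∨ n Σs' Θs' As (side-mono side) hasPartner Υ-C₁ Υ-C₂ Γ'≐) ,
     reg⊑ Γ⊆Γ'

lemma4p1 : (G : Fm) (R : Rule) (ps : List Seq) (σ : Seq) (ps' : List Seq) →
    Instance G R ps σ →
    All (WF G) ps' →
    Pointwise _⊑_ ps ps' →
    Σ[ σ' ∈ Seq ] (Instance G R ps' σ' × σ ⊑ σ')
lemma4p1 G R ps σ ps' (_ , wf-σ , rule) = monotone R wf-σ rule
  where
    monotone : ∀ R → Monotone G R
    monotone axReg = axReg-monotone
    monotone axIrr = axIrr-monotone
    monotone ∧Reg = ∧Reg-monotone
    monotone ∧Irr = ∧Irr-monotone
    monotone ∨Irr = ∨Irr-monotone
    monotone ⊃∈Reg = ⊃∈Reg-monotone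
    monotone ⊃∈Irr = ⊃∈Irr-monotone
    monotone ⊃∉ = ⊃∉-monotone
    monotone ⋈At = ⋈At-monotone
    monotone ⋈∨ = ⋈∨-monotone
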